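{- Let $d$ be a square-free negative integer with $d\equiv1\pmod4$, let $n,m$ be positive odd integers, and put $\tau=\frac12+\frac{n}{m}\sqrt{d}$. Then the elliptic curve $\mathcal{E}_\tau$ is even.
   Context: For a negative real number $d$, $\sqrt{d}$ denotes $\sqrt{|d|}\,\mathbf{i}$. For $\tau$ in the complex upper half-plane, $\mathcal{E}_\tau$ is the complex elliptic curve with $\mathcal{E}_\tau(\mathbb{C})\cong\mathbb{C}/(\mathbb{Z}\tau+\mathbb{Z})$. An order in a quadratic field is odd (resp. even) if its discriminant (the discriminant of the trace form $(a,b)\mapsto\mathrm{tr}(ab)$) is odd (resp. even); a CM elliptic curve $E$ over $\mathbb{C}$ is odd (resp. even) if the order $\mathrm{End}(E)$ is odd (resp. even). -}

module Defs where

open import Data.Nat as ℕ using (ℕ; NonZero)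
open import Data.Integer as ℤ using (ℤ; +_; ∣_∣)
open import Data.Rational as ℚ using (ℚ; ½; _/_)
open import Data.Nat.Divisibility using (_∣_)
open import Data.Product using (Σ; _×_; _,_)
open import Relation.Binary.PropositionalEquality using (_≡_)

-- Elements a + b·√d of the quadratic field K = ℚ(√d), stored as pairs (a , b).
-- (For d < 0, √d = √|d|·i as in the paper.)
record K : Set where
  constructor _+√d·_
  field
    re : ℚ
    im : ℚ
open K public

ι : ℤ → K
ι a = (a / 1) +√d· ℚ.0ℚ

_⊕_ : K → K → K
(a +√d· b) ⊕ (c +√d· e) = (a ℚ.+ c) +√d· (b ℚ.+ e)

mulK : ℤ → K → K → K
mulK d (a +√d· b) (c +√d· e) =
  ((a ℚ.* c) ℚ.+ ((d / 1) ℚ.* (b ℚ.* e))) +√d· ((a ℚ.* e) ℚ.+ (b ℚ.* c))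

tr : K → ℚ
tr x = (+ 2 / 1) ℚ.* re x

tauK : (n m : ℕ) → .{{NonZero m}} → K
tauK n m = ½ +√d· ((+ n) / m)

InLattice : K → K → Set
InLattice τ x = Σ ℤ λ a → Σ ℤ λ b → x ≡ (mulK0 a τ ⊕ ι b)
  where
  mulK0 : ℤ → K → K
  mulK0 a (u +√d· v) = ((a / 1) ℚ.* u) +√d· ((a / 1) ℚ.* v)

-- End(𝓔_τ) = End(ℂ/Λ) ≅ {α ∈ ℂ : αΛ ⊆ Λ}.  Since 1 ∈ Λ, any such α lies in Λ ⊆ K,
-- so it suffices to range over α ∈ K.
InEnd : ℤ → K → K → Set
InEnd d τ α = ∀ x → InLattice τ x → InLattice τ (mulK d α x)

IsZBasis : ℤ → (K → Set) → K → K → Set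
IsZBasis d P β₁ β₂ =
  P β₁ × P β₂
  × (∀ α → P α → Σ ℤ λ a → Σ ℤ λ b → α ≡ (mulK d (ι a) β₁ ⊕ mulK d (ι b) β₂))
  × (∀ a b → (mulK d (ι a) β₁ ⊕ mulK d (ι b) β₂) ≡ ι (+ 0) → (a ≡ + 0) × (b ≡ + 0))

disc : ℤ → K → K → ℚ
disc d β₁ β₂ =
  (tr (mulK d β₁ β₁) ℚ.* tr (mulK d β₂ β₂)) ℚ.- (tr (mulK d β₁ β₂) ℚ.* tr (mulK d β₂ β₁))

EvenQ : ℚ → Set
EvenQ q = Σ ℤ λ k → q ≡ ((+ 2 ℤ.* k) / 1)

IsEvenCurve : ℤ → K → Set
IsEvenCurve d τ =
  (Σ K λ β₁ → Σ K λ β₂ → IsZBasis d (InEnd d τ) β₁ β₂)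
  × (∀ β₁ β₂ → IsZBasis d (InEnd d τ) β₁ β₂ → EvenQ (disc d β₁ β₂))

SquareFree : ℤ → Set
SquareFree d = ∀ (k : ℕ) → (k ℕ.* k) ∣ ∣ d ∣ → k ≡ 1

OddN : ℕ → Set
OddN n = Σ ℕ λ k → n ≡ ℕ.suc (2 ℕ.* k)

-- Since τ² = tr(τ)·τ − N(τ), an element
-- α = aτ + b sends Λ into itself iff a·N(τ) ∈ ℤ, i.e. iff the denominator of N(τ) divides a;
-- this gives End(𝓔_τ) = ℤ ⊕ ℤ·den(N(τ))·τ. For τ = 1/2 + (n/m)√d one has
-- 4m²·N(τ) = m² − 4n²d, which is odd when m is odd, so a·N(τ) ∈ ℤ forces a to be even.
-- With a, a' even and tr τ = 1, the trace tr((aτ + b)(a'τ + b')) is an even integer, so every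
-- entry of the trace-form matrix, and hence the discriminant, is even.
module Submission where

open import Defs
open import Data.Nat using (ℕ; NonZero)
open import Data.Product using (Σ)
open import Relation.Binary.PropositionalEquality using (_≡_; refl)

module EndomorphismRing where

  open import Level using (0ℓ)
  open import Data.Nat as ℕ using (suc)
  import Data.Nat.Properties as ℕP
  import Data.Nat.Coprimality as ℕC
  open import Data.Integer as ℤ using (ℤ; +_)
  import Data.Integer.Properties as ℤP
  import Data.Integer.Coprimality as ℤC
  open import Data.Integer.Divisibility.Signed using (_∣_; divides; ∣⇒∣ᵤ; ∣ᵤ⇒∣)
  open import Data.Integer.GCD using (gcd)
  import Data.Integer.Tactic.RingSolver as ℤ-Ring
  open import Data.Rational
    using (ℚ; mkℚ; ½; _/_; 0ℚ; ↥_; ↧_; 1/_; toℚᵘ; ≢-nonZero; _+_; _*_; _-_; -_)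
  import Data.Rational.Properties as ℚP
  open import Data.Rational.Unnormalised as ℚᵘ using (mkℚᵘ; *≡*)
  import Data.Rational.Unnormalised.Properties as ℚᵘP
  import Algebra.Properties.Group ℚP.+-0-group as ℚ-+
  open import Data.Product using (_,_; _×_; proj₁; proj₂)
  open import Function.Bundles using (_⇔_; mk⇔; Equivalence)
  open import Relation.Binary.PropositionalEquality
    using (_≢_; refl; sym; trans; cong; cong₂; subst; module ≡-Reasoning)
  open import Relation.Nullary.Decidable using (dec⇒maybe)
  open import Tactic.RingSolver using (solve-∀)
  open import Tactic.RingSolver.Core.AlmostCommutativeRing
    using (AlmostCommutativeRing; fromCommutativeRing)

  ℚ-ring : AlmostCommutativeRing 0ℓ 0ℓ
  ℚ-ring = fromCommutativeRing ℚP.+-*-commutativeRing (λ x → dec⇒maybe (0ℚ ℚP.≟ x))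

  IsInt : ℚ → Set
  IsInt x = Σ ℤ λ k → x ≡ k / 1

  toℚᵘ-/1 : ∀ i → toℚᵘ (i / 1) ℚᵘ.≃ mkℚᵘ i 0
  toℚᵘ-/1 i = ℚP.toℚᵘ-fromℚᵘ (mkℚᵘ i 0)

  /1-injective : ∀ {i j} → i / 1 ≡ j / 1 → i ≡ j
  /1-injective {i} {j} i≡j with ℚP./-injective-≃ (mkℚᵘ i 0) (mkℚᵘ j 0) i≡j
  ... | *≡* i*1≡j*1 = ℤP.*-cancelʳ-≡ i j (+ 1) i*1≡j*1

  /1-+ : ∀ i j → (i ℤ.+ j) / 1 ≡ i / 1 + j / 1
  /1-+ i j = ℚP.toℚᵘ-injective (begin
    toℚᵘ ((i ℤ.+ j) / 1)             ≈⟨ toℚᵘ-/1 (i ℤ.+ j) ⟩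
    mkℚᵘ (i ℤ.+ j) 0                 ≈⟨ *≡* (cong (ℤ._* + 1) (sym (cong₂ ℤ._+_ (ℤP.*-identityʳ i) (ℤP.*-identityʳ j)))) ⟩
    mkℚᵘ i 0 ℚᵘ.+ mkℚᵘ j 0           ≈⟨ ℚᵘP.+-cong (toℚᵘ-/1 i) (toℚᵘ-/1 j) ⟨
    toℚᵘ (i / 1) ℚᵘ.+ toℚᵘ (j / 1)   ≈⟨ ℚP.toℚᵘ-homo-+ (i / 1) (j / 1) ⟨
    toℚᵘ (i / 1 + j / 1)             ∎)
    where open ℚᵘP.≃-Reasoning

  /1-* : ∀ i j → (i ℤ.* j) / 1 ≡ (i / 1) * (j / 1)
  /1-* i j = ℚP.toℚᵘ-injective (begin
    toℚᵘ ((i ℤ.* j) / 1)             ≈⟨ toℚᵘ-/1 (i ℤ.* j) ⟩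
    mkℚᵘ i 0 ℚᵘ.* mkℚᵘ j 0           ≈⟨ ℚᵘP.*-cong (toℚᵘ-/1 i) (toℚᵘ-/1 j) ⟨
    toℚᵘ (i / 1) ℚᵘ.* toℚᵘ (j / 1)   ≈⟨ ℚP.toℚᵘ-homo-* (i / 1) (j / 1) ⟨
    toℚᵘ ((i / 1) * (j / 1))         ∎)
    where open ℚᵘP.≃-Reasoning

  /1-neg : ∀ i → (ℤ.- i) / 1 ≡ - (i / 1)
  /1-neg i = ℚP.toℚᵘ-injective (begin
    toℚᵘ ((ℤ.- i) / 1)   ≈⟨ toℚᵘ-/1 (ℤ.- i) ⟩
    ℚᵘ.- mkℚᵘ i 0        ≈⟨ ℚᵘP.-‿cong (toℚᵘ-/1 i) ⟨
    ℚᵘ.- toℚᵘ (i / 1)    ≈⟨ ℚP.toℚᵘ-homo‿- (i / 1) ⟨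
    toℚᵘ (- (i / 1))     ∎)
    where open ℚᵘP.≃-Reasoning

  /1-- : ∀ i j → (i ℤ.- j) / 1 ≡ i / 1 - j / 1
  /1-- i j = trans (/1-+ i (ℤ.- j)) (cong (_+_ (i / 1)) (/1-neg j))

  /1-*≡/1⇔ : ∀ a x k → (a / 1 * x ≡ k / 1) ⇔ (a ℤ.* ↥ x ≡ k ℤ.* ↧ x)
  /1-*≡/1⇔ a x@(mkℚ p e _) k = mk⇔ to from
    where
    open ℚᵘP.≃-Reasoning
    product≃ : toℚᵘ (a / 1 * x) ℚᵘ.≃ mkℚᵘ (a ℤ.* p) e
    product≃ = begin
      toℚᵘ (a / 1 * x)            ≈⟨ ℚP.toℚᵘ-homo-* (a / 1) x ⟩
      toℚᵘ (a / 1) ℚᵘ.* mkℚᵘ p e  ≈⟨ ℚᵘP.*-congʳ (toℚᵘ-/1 a) ⟩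
      mkℚᵘ a 0 ℚᵘ.* mkℚᵘ p e      ≈⟨ *≡* (cong (λ n → a ℤ.* p ℤ.* + suc n) (sym (ℕP.+-identityʳ e))) ⟩
      mkℚᵘ (a ℤ.* p) e            ∎
    to : a / 1 * x ≡ k / 1 → a ℤ.* p ≡ k ℤ.* + suc e
    to eq with ℚᵘP.≃-trans (ℚᵘP.≃-sym product≃) (ℚᵘP.≃-trans (ℚP.toℚᵘ-cong eq) (toℚᵘ-/1 k))
    ... | *≡* ap*1≡k*den = trans (sym (ℤP.*-identityʳ (a ℤ.* p))) ap*1≡k*den
    from : a ℤ.* p ≡ k ℤ.* + suc e → a / 1 * x ≡ k / 1
    from eq = ℚP.toℚᵘ-injective (begin
      toℚᵘ (a / 1 * x)   ≈⟨ product≃ ⟩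
      mkℚᵘ (a ℤ.* p) e   ≈⟨ *≡* (trans (ℤP.*-identityʳ (a ℤ.* p)) eq) ⟩
      mkℚᵘ k 0           ≈⟨ toℚᵘ-/1 k ⟨
      toℚᵘ (k / 1)       ∎)

  -- Uses that the numerator and denominator of a normalised rational are coprime.
  isInt-*⇔↧∣ : ∀ a x → IsInt (a / 1 * x) ⇔ ↧ x ∣ a
  isInt-*⇔↧∣ a x@(mkℚ p e coprime) = mk⇔ to from
    where
    to : IsInt (a / 1 * x) → ↧ x ∣ a
    to (k , eq) = ∣ᵤ⇒∣ (ℤC.coprime-divisor (↧ x) p a (ℕC.sym (ℕC.recompute coprime))
      (∣⇒∣ᵤ (divides k (trans (ℤP.*-comm p a) (Equivalence.to (/1-*≡/1⇔ a x k) eq)))))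
    from : ↧ x ∣ a → IsInt (a / 1 * x)
    from (divides j refl) = j ℤ.* p , Equivalence.from (/1-*≡/1⇔ a x (j ℤ.* p)) (swap j (↧ x) p)
      where
      swap : ∀ i j k → i ℤ.* j ℤ.* k ≡ i ℤ.* k ℤ.* j
      swap = ℤ-Ring.solve-∀

  ↧-nonZero : ∀ x → ℤ.NonZero (↧ x)
  ↧-nonZero (mkℚ _ _ _) = _

  /≢0 : ∀ {i} m .{{_ : NonZero m}} → i ≢ + 0 → i / m ≢ 0ℚ
  /≢0 {i} m i≢0 i/m≡0 = i≢0 (begin
    i                          ≡⟨ ℚP.↥-/ i m ⟨
    ↥ (i / m) ℤ.* gcd i (+ m)  ≡⟨ cong (λ q → ↥ q ℤ.* gcd i (+ m)) i/m≡0 ⟩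
    + 0 ℤ.* gcd i (+ m)        ≡⟨ ℤP.*-zeroˡ (gcd i (+ m)) ⟩
    + 0                        ∎)
    where open ≡-Reasoning

  /-*-denominator : ∀ i m .{{_ : NonZero m}} → i / m * (+ m / 1) ≡ i / 1
  /-*-denominator i m@(suc m-1) = ℚP.toℚᵘ-injective (begin
    toℚᵘ (i / m * (+ m / 1))          ≈⟨ ℚP.toℚᵘ-homo-* (i / m) (+ m / 1) ⟩
    toℚᵘ (i / m) ℚᵘ.* toℚᵘ (+ m / 1)  ≈⟨ ℚᵘP.*-cong (ℚP.toℚᵘ-fromℚᵘ (mkℚᵘ i m-1)) (toℚᵘ-/1 (+ m)) ⟩
    mkℚᵘ i m-1 ℚᵘ.* mkℚᵘ (+ m) 0      ≈⟨ *≡* cancel-m ⟩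
    mkℚᵘ i 0                          ≈⟨ toℚᵘ-/1 i ⟨
    toℚᵘ (i / 1)                      ∎)
    where
    open ℚᵘP.≃-Reasoning
    cancel-m : i ℤ.* + m ℤ.* + 1 ≡ i ℤ.* + suc (m-1 ℕ.* 1)
    cancel-m rewrite ℕP.*-identityʳ m-1 = ℤP.*-identityʳ (i ℤ.* + m)

  *-cancelʳ-≢0 : ∀ {v} x y → v ≢ 0ℚ → x * v ≡ y * v → x ≡ y
  *-cancelʳ-≢0 {v} x y v≢0 xv≡yv = begin
    x              ≡⟨ divide-back x ⟨
    x * v * 1/ v   ≡⟨ cong (_* 1/ v) xv≡yv ⟩
    y * v * 1/ v   ≡⟨ divide-back y ⟩
    y              ∎
    where
    open ≡-Reasoning
    instance _ = ≢-nonZero v≢0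
    divide-back : ∀ z → z * v * 1/ v ≡ z
    divide-back z = trans (ℚP.*-assoc z v (1/ v)) (trans (cong (z *_) (ℚP.*-inverseʳ v)) (ℚP.*-identityʳ z))

  isInt-+ : ∀ {x y} → IsInt x → IsInt y → IsInt (x + y)
  isInt-+ (i , refl) (j , refl) = i ℤ.+ j , sym (/1-+ i j)

  isInt-* : ∀ {x y} → IsInt x → IsInt y → IsInt (x * y)
  isInt-* (i , refl) (j , refl) = i ℤ.* j , sym (/1-* i j)

  isInt-- : ∀ {x y} → IsInt x → IsInt y → IsInt (x - y)
  isInt-- (i , refl) (j , refl) = i ℤ.- j , sym (/1-- i j)

  even⇒isInt : ∀ {x} → EvenQ x → IsInt x
  even⇒isInt (k , x≡2k) = + 2 ℤ.* k , x≡2k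

  even-+ : ∀ {x y} → EvenQ x → EvenQ y → EvenQ (x + y)
  even-+ (k , refl) (j , refl) = k ℤ.+ j ,
    trans (sym (/1-+ (+ 2 ℤ.* k) (+ 2 ℤ.* j))) (cong (_/ 1) (sym (ℤP.*-distribˡ-+ (+ 2) k j)))

  even-*ʳ : ∀ {x y} → EvenQ x → IsInt y → EvenQ (x * y)
  even-*ʳ (k , refl) (j , refl) = k ℤ.* j ,
    trans (sym (/1-* (+ 2 ℤ.* k) j)) (cong (_/ 1) (ℤP.*-assoc (+ 2) k j))

  even-2* : ∀ {x} → IsInt x → EvenQ (+ 2 / 1 * x)
  even-2* (k , refl) = k , sym (/1-* (+ 2) k)

  even-- : ∀ {x y} → EvenQ x → EvenQ y → EvenQ (x - y)
  even-- even-x (j , refl) = even-+ even-x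
    (ℤ.- j , trans (sym (/1-neg (+ 2 ℤ.* j))) (cong (_/ 1) (ℤP.neg-distribʳ-* (+ 2) j)))

  even-det : ∀ {p q r s} → EvenQ p → EvenQ q → EvenQ r → EvenQ s → EvenQ (p * q - r * s)
  even-det even-p even-q even-r even-s =
    even-- (even-*ʳ even-p (even⇒isInt even-q)) (even-*ʳ even-r (even⇒isInt even-s))

  _·_ : ℚ → K → K
  x · α = (x * re α) +√d· (x * im α)

  fromℚ : ℚ → K
  fromℚ y = y +√d· 0ℚ

  -- xτ + y. For x = a / 1 and y = b / 1 this is definitionally the point of InLattice τ
  -- with coordinates (a , b).
  lin : K → ℚ → ℚ → K
  lin τ x y = (x · τ) ⊕ fromℚ y

  lat : K → ℤ → ℤ → K
  lat τ a b = lin τ (a / 1) (b / 1)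

  norm : ℤ → K → ℚ
  norm d α = re α * re α - d / 1 * (im α * im α)

  lin-injective : ∀ τ {x y x' y'} → im τ ≢ 0ℚ → lin τ x y ≡ lin τ x' y' → x ≡ x' × y ≡ y'
  lin-injective τ {x} {y} {x'} {y'} im≢0 eq = x≡x' , ℚ-+.∙-cancelˡ (x' * re τ) y y' re-eq
    where
    x≡x' : x ≡ x'
    x≡x' = *-cancelʳ-≢0 x x' im≢0
      (trans (sym (ℚP.+-identityʳ (x * im τ))) (trans (cong im eq) (ℚP.+-identityʳ (x' * im τ))))
    re-eq : x' * re τ + y ≡ x' * re τ + y'
    re-eq = trans (cong (λ z → z * re τ + y) (sym x≡x')) (cong re eq)

  inLattice : ∀ τ {x y} → IsInt x → IsInt y → InLattice τ (lin τ x y)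
  inLattice τ (a , refl) (b , refl) = a , b , refl

  record EndElement (d : ℤ) (τ α : K) : Set where
    constructor endElement
    field
      a b : ℤ
      α≡aτ+b : α ≡ lat τ a b
      a·norm-integral : IsInt (a / 1 * norm d τ)

  module _ (d : ℤ) (τ : K) where

    mulK-lin : ∀ x y x' y' →
      mulK d (lin τ x y) (lin τ x' y') ≡ lin τ (x * x' * tr τ + x * y' + x' * y) (y * y' - x * norm d τ * x')
    mulK-lin x y x' y' = cong₂ _+√d·_ (re-identity (re τ) (im τ) (d / 1) x y x' y') (im-identity (re τ) (im τ) x y x' y')
      where
      re-identity : ∀ u v D x y x' y' →
        (x * u + y) * (x' * u + y') + D * ((x * v + 0ℚ) * (x' * v + 0ℚ))
          ≡ (x * x' * (+ 2 / 1 * u) + x * y' + x' * y) * u + (y * y' - x * (u * u - D * (v * v)) * x')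
      re-identity = solve-∀ ℚ-ring
      im-identity : ∀ u v x y x' y' →
        (x * u + y) * (x' * v + 0ℚ) + (x * v + 0ℚ) * (x' * u + y')
          ≡ (x * x' * (+ 2 / 1 * u) + x * y' + x' * y) * v + 0ℚ
      im-identity = solve-∀ ℚ-ring

    mulK-lin-τ : ∀ x y → mulK d (lin τ x y) τ ≡ lin τ (x * tr τ + y) (- (x * norm d τ))
    mulK-lin-τ x y = cong₂ _+√d·_ (re-identity (re τ) (im τ) (d / 1) x y) (im-identity (re τ) (im τ) x y)
      where
      re-identity : ∀ u v D x y →
        (x * u + y) * u + D * ((x * v + 0ℚ) * v) ≡ (x * (+ 2 / 1 * u) + y) * u + - (x * (u * u - D * (v * v)))
      re-identity = solve-∀ ℚ-ring
      im-identity : ∀ u v x y → (x * u + y) * v + (x * v + 0ℚ) * u ≡ (x * (+ 2 / 1 * u) + y) * v + 0ℚ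
      im-identity = solve-∀ ℚ-ring

    tr-lin : ∀ x y → tr (lin τ x y) ≡ x * tr τ + + 2 / 1 * y
    tr-lin x y = identity (re τ) x y
      where
      identity : ∀ u x y → + 2 / 1 * (x * u + y) ≡ x * (+ 2 / 1 * u) + + 2 / 1 * y
      identity = solve-∀ ℚ-ring

    mulK-identityʳ : ∀ α → mulK d α (ι (+ 1)) ≡ α
    mulK-identityʳ α = cong₂ _+√d·_ (re-identity (re α) (im α) (d / 1)) (im-identity (re α) (im α))
      where
      re-identity : ∀ r s D → r * (+ 1 / 1) + D * (s * 0ℚ) ≡ r
      re-identity = solve-∀ ℚ-ring
      im-identity : ∀ r s → r * 0ℚ + s * (+ 1 / 1) ≡ s
      im-identity = solve-∀ ℚ-ring

    ι≡lat : ∀ b → ι b ≡ lat τ (+ 0) b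
    ι≡lat b = cong₂ _+√d·_ (re-identity (re τ) (b / 1)) (im-identity (im τ))
      where
      re-identity : ∀ u b → b ≡ + 0 / 1 * u + b
      re-identity = solve-∀ ℚ-ring
      im-identity : ∀ v → 0ℚ ≡ + 0 / 1 * v + 0ℚ
      im-identity = solve-∀ ℚ-ring

    τ≡lat : τ ≡ lat τ (+ 1) (+ 0)
    τ≡lat = cong₂ _+√d·_ (re-identity (re τ)) (im-identity (im τ))
      where
      re-identity : ∀ u → u ≡ + 1 / 1 * u + + 0 / 1
      re-identity = solve-∀ ℚ-ring
      im-identity : ∀ v → v ≡ + 1 / 1 * v + 0ℚ
      im-identity = solve-∀ ℚ-ring

    combination≡lat : ∀ a b c →
      (mulK d (ι a) (lat τ (+ 0) (+ 1)) ⊕ mulK d (ι b) (lat τ c (+ 0))) ≡ lat τ (b ℤ.* c) a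
    combination≡lat a b c = trans
      (cong₂ _+√d·_ (re-identity (re τ) (im τ) (d / 1) (a / 1) (b / 1) (c / 1))
                    (im-identity (re τ) (im τ) (a / 1) (b / 1) (c / 1)))
      (cong (λ z → lin τ z (a / 1)) (sym (/1-* b c)))
      where
      re-identity : ∀ u v D a b c →
        a * (+ 0 / 1 * u + + 1 / 1) + D * (0ℚ * (+ 0 / 1 * v + 0ℚ)) + (b * (c * u + + 0 / 1) + D * (0ℚ * (c * v + 0ℚ)))
          ≡ b * c * u + a
      re-identity = solve-∀ ℚ-ring
      im-identity : ∀ u v a b c →
        a * (+ 0 / 1 * v + 0ℚ) + 0ℚ * (+ 0 / 1 * u + + 1 / 1) + (b * (c * v + 0ℚ) + 0ℚ * (c * u + + 0 / 1))
          ≡ b * c * v + 0ℚ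
      im-identity = solve-∀ ℚ-ring

    -- Testing α on 1 and on τ already forces its shape.
    inEnd⇒endElement : im τ ≢ 0ℚ → ∀ {α} → InEnd d τ α → EndElement d τ α
    inEnd⇒endElement im≢0 {α} α∈End =
      fromImages (α∈End (ι (+ 1)) (+ 0 , + 1 , ι≡lat (+ 1))) (α∈End τ (+ 1 , + 0 , τ≡lat))
      where
      fromImages : InLattice τ (mulK d α (ι (+ 1))) → InLattice τ (mulK d α τ) → EndElement d τ α
      fromImages (a , b , α·1≡) (a' , b' , α·τ≡) = endElement a b α≡ (ℤ.- b' , a·norm≡)
        where
        α≡ : α ≡ lat τ a b
        α≡ = trans (sym (mulK-identityʳ α)) α·1≡
        -a·norm≡b' : - (a / 1 * norm d τ) ≡ b' / 1
        -a·norm≡b' = proj₂ (lin-injective τ {a / 1 * tr τ + b / 1} { - (a / 1 * norm d τ)} {a' / 1} {b' / 1} im≢0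
          (trans (sym (mulK-lin-τ (a / 1) (b / 1))) (trans (cong (λ β → mulK d β τ) (sym α≡)) α·τ≡)))
        a·norm≡ : a / 1 * norm d τ ≡ (ℤ.- b') / 1
        a·norm≡ = trans (sym (ℚ-+.⁻¹-involutive _)) (trans (cong -_ -a·norm≡b') (sym (/1-neg b')))

    endElement⇒inEnd : IsInt (tr τ) → ∀ {α} → EndElement d τ α → InEnd d τ α
    endElement⇒inEnd t (endElement a b refl a·norm) x (a' , b' , refl) =
      subst (InLattice τ) (sym (mulK-lin (a / 1) (b / 1) (a' / 1) (b' / 1)))
        (inLattice τ
          (isInt-+ (isInt-+ (isInt-* (isInt-* (a , refl) (a' , refl)) t) (isInt-* (a , refl) (b' , refl)))
                   (isInt-* (a' , refl) (b , refl)))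
          (isInt-- (isInt-* (b , refl) (b' , refl)) (isInt-* a·norm (a' , refl))))

    tr-mulK-even : IsInt (tr τ) → ∀ {α β} (p : EndElement d τ α) (q : EndElement d τ β) →
      EvenQ (EndElement.a p / 1) → EvenQ (EndElement.a q / 1) → EvenQ (tr (mulK d α β))
    tr-mulK-even t (endElement a b refl a·norm) (endElement a' b' refl _) even-a even-a' =
      subst EvenQ (sym (trans (cong tr (mulK-lin (a / 1) (b / 1) (a' / 1) (b' / 1))) (tr-lin X Y)))
        (even-+ (even-*ʳ X-even t) (even-2* Y-integral))
      where
      X Y : ℚ
      X = a / 1 * (a' / 1) * tr τ + a / 1 * (b' / 1) + a' / 1 * (b / 1)
      Y = b / 1 * (b' / 1) - a / 1 * norm d τ * (a' / 1)
      X-even : EvenQ X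
      X-even = even-+ (even-+ (even-*ʳ (even-*ʳ even-a (a' , refl)) t) (even-*ʳ even-a (b' , refl)))
                      (even-*ʳ even-a' (b , refl))
      Y-integral : IsInt Y
      Y-integral = isInt-- (isInt-* (b , refl) (b' , refl)) (isInt-* a·norm (a' , refl))

  module _ (d : ℤ) (τ : K) (im≢0 : im τ ≢ 0ℚ) (tr-integral : IsInt (tr τ)) where

    N : ℤ
    N = ↧ (norm d τ)

    order-basis : IsZBasis d (InEnd d τ) (lat τ (+ 0) (+ 1)) (lat τ N (+ 0))
    order-basis = one∈End , Nτ∈End , span , independent
      where
      one∈End : InEnd d τ (lat τ (+ 0) (+ 1))
      one∈End = endElement⇒inEnd d τ tr-integral (endElement (+ 0) (+ 1) refl
        (Equivalence.from (isInt-*⇔↧∣ (+ 0) (norm d τ)) (divides (+ 0) (sym (ℤP.*-zeroˡ N)))))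
      Nτ∈End : InEnd d τ (lat τ N (+ 0))
      Nτ∈End = endElement⇒inEnd d τ tr-integral (endElement N (+ 0) refl
        (Equivalence.from (isInt-*⇔↧∣ N (norm d τ)) (divides (+ 1) (sym (ℤP.*-identityˡ N)))))
      span : ∀ α → InEnd d τ α →
        Σ ℤ λ a → Σ ℤ λ b → α ≡ (mulK d (ι a) (lat τ (+ 0) (+ 1)) ⊕ mulK d (ι b) (lat τ N (+ 0)))
      span α α∈End = fromElement (inEnd⇒endElement d τ im≢0 α∈End)
        where
        fromElement : EndElement d τ α →
          Σ ℤ λ a → Σ ℤ λ b → α ≡ (mulK d (ι a) (lat τ (+ 0) (+ 1)) ⊕ mulK d (ι b) (lat τ N (+ 0)))
        fromElement (endElement a b α≡ a·norm) =
          b , k , trans α≡ (trans (cong (λ z → lat τ z b) a≡k*N) (sym (combination≡lat d τ b k N)))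
          where
          open _∣_ (Equivalence.to (isInt-*⇔↧∣ a (norm d τ)) a·norm) renaming (quotient to k; equality to a≡k*N)
      independent : ∀ a b →
        (mulK d (ι a) (lat τ (+ 0) (+ 1)) ⊕ mulK d (ι b) (lat τ N (+ 0))) ≡ ι (+ 0) → a ≡ + 0 × b ≡ + 0
      independent a b combination≡0 =
        /1-injective (proj₂ coordinates≡0) ,
        ℤP.*-cancelʳ-≡ b (+ 0) N {{↧-nonZero (norm d τ)}}
          (trans (/1-injective (proj₁ coordinates≡0)) (sym (ℤP.*-zeroˡ N)))
        where
        coordinates≡0 : (b ℤ.* N) / 1 ≡ + 0 / 1 × a / 1 ≡ + 0 / 1
        coordinates≡0 = lin-injective τ im≢0
          (trans (sym (combination≡lat d τ a b N)) (trans combination≡0 (ι≡lat d τ (+ 0))))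

  even-of-*-odd : ∀ a w z → a ℤ.* (+ 1 ℤ.+ + 2 ℤ.* w) ≡ + 2 ℤ.* z → a ≡ + 2 ℤ.* (z ℤ.- a ℤ.* w)
  even-of-*-odd a w z a*odd≡2z = begin
    a                                                ≡⟨ split a w ⟩
    a ℤ.* (+ 1 ℤ.+ + 2 ℤ.* w) ℤ.- + 2 ℤ.* (a ℤ.* w)  ≡⟨ cong (ℤ._- + 2 ℤ.* (a ℤ.* w)) a*odd≡2z ⟩
    + 2 ℤ.* z ℤ.- + 2 ℤ.* (a ℤ.* w)                  ≡⟨ factor z (a ℤ.* w) ⟩
    + 2 ℤ.* (z ℤ.- a ℤ.* w)                          ∎
    where
    open ≡-Reasoning
    split : ∀ a w → a ≡ a ℤ.* (+ 1 ℤ.+ + 2 ℤ.* w) ℤ.- + 2 ℤ.* (a ℤ.* w)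
    split = ℤ-Ring.solve-∀
    factor : ∀ z y → + 2 ℤ.* z ℤ.- + 2 ℤ.* y ≡ + 2 ℤ.* (z ℤ.- y)
    factor = ℤ-Ring.solve-∀

  module _ (d : ℤ) (n m : ℕ) .{{_ : NonZero m}} where

    norm-tauK-scaled : norm d (tauK n m) * ((+ 4 ℤ.* (+ m ℤ.* + m)) / 1)
                     ≡ (+ m ℤ.* + m ℤ.- + 4 ℤ.* d ℤ.* (+ n ℤ.* + n)) / 1
    norm-tauK-scaled = begin
      (½ * ½ - D * (q * q)) * ((+ 4 ℤ.* (+ m ℤ.* + m)) / 1)  ≡⟨ cong ((½ * ½ - D * (q * q)) *_) F-cast ⟩
      (½ * ½ - D * (q * q)) * (+ 4 / 1 * (m̂ * m̂))          ≡⟨ clear-denominators D q m̂ ⟩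
      m̂ * m̂ - + 4 / 1 * D * ((q * m̂) * (q * m̂))            ≡⟨ cong (λ z → m̂ * m̂ - + 4 / 1 * D * (z * z)) q*m̂≡n̂ ⟩
      m̂ * m̂ - + 4 / 1 * D * (n̂ * n̂)                        ≡⟨ C-cast ⟨
      (+ m ℤ.* + m ℤ.- + 4 ℤ.* d ℤ.* (+ n ℤ.* + n)) / 1     ∎
      where
      open ≡-Reasoning
      D q m̂ n̂ : ℚ
      D = d / 1
      q = + n / m
      m̂ = + m / 1
      n̂ = + n / 1
      q*m̂≡n̂ : q * m̂ ≡ n̂
      q*m̂≡n̂ = /-*-denominator (+ n) m
      F-cast : (+ 4 ℤ.* (+ m ℤ.* + m)) / 1 ≡ + 4 / 1 * (m̂ * m̂)
      F-cast = trans (/1-* (+ 4) (+ m ℤ.* + m)) (cong (+ 4 / 1 *_) (/1-* (+ m) (+ m)))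
      C-cast : (+ m ℤ.* + m ℤ.- + 4 ℤ.* d ℤ.* (+ n ℤ.* + n)) / 1 ≡ m̂ * m̂ - + 4 / 1 * D * (n̂ * n̂)
      C-cast = trans (/1-- (+ m ℤ.* + m) (+ 4 ℤ.* d ℤ.* (+ n ℤ.* + n)))
        (cong₂ _-_ (/1-* (+ m) (+ m))
                   (trans (/1-* (+ 4 ℤ.* d) (+ n ℤ.* + n)) (cong₂ _*_ (/1-* (+ 4) d) (/1-* (+ n) (+ n)))))
      clear-denominators : ∀ D q m̂ →
        (½ * ½ - D * (q * q)) * (+ 4 / 1 * (m̂ * m̂)) ≡ m̂ * m̂ - + 4 / 1 * D * ((q * m̂) * (q * m̂))
      clear-denominators = solve-∀ ℚ-ring

    a·norm-integral⇒even : OddN m → ∀ a → IsInt (a / 1 * norm d (tauK n m)) → EvenQ (a / 1)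
    a·norm-integral⇒even (j , m≡1+2j) a (k , a·norm≡k) =
      z ℤ.- a ℤ.* w , cong (_/ 1) (even-of-*-odd a w z aC≡2z)
      where
      open ≡-Reasoning
      C F : ℤ → ℤ
      C M = M ℤ.* M ℤ.- + 4 ℤ.* d ℤ.* (+ n ℤ.* + n)
      F M = + 4 ℤ.* (M ℤ.* M)
      aC≡kF : a ℤ.* C (+ m) ≡ k ℤ.* F (+ m)
      aC≡kF = /1-injective (begin
        (a ℤ.* C (+ m)) / 1                          ≡⟨ /1-* a (C (+ m)) ⟩
        a / 1 * (C (+ m) / 1)                        ≡⟨ cong (a / 1 *_) norm-tauK-scaled ⟨
        a / 1 * (norm d (tauK n m) * (F (+ m) / 1))  ≡⟨ ℚP.*-assoc (a / 1) (norm d (tauK n m)) (F (+ m) / 1) ⟨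
        a / 1 * norm d (tauK n m) * (F (+ m) / 1)    ≡⟨ cong (_* (F (+ m) / 1)) a·norm≡k ⟩
        k / 1 * (F (+ m) / 1)                        ≡⟨ /1-* k (F (+ m)) ⟨
        (k ℤ.* F (+ m)) / 1                          ∎)
      M M² w z : ℤ
      M = + 1 ℤ.+ + 2 ℤ.* + j
      M² = M ℤ.* M
      w = + 2 ℤ.* + j ℤ.+ + 2 ℤ.* (+ j ℤ.* + j) ℤ.- + 2 ℤ.* d ℤ.* (+ n ℤ.* + n)
      z = + 2 ℤ.* M² ℤ.* k
      m≡M : + m ≡ M
      m≡M = trans (cong +_ m≡1+2j) (cong (ℤ._+_ (+ 1)) (ℤP.pos-* 2 j))
      aC≡2z : a ℤ.* (+ 1 ℤ.+ + 2 ℤ.* w) ≡ + 2 ℤ.* z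
      aC≡2z = begin
        a ℤ.* (+ 1 ℤ.+ + 2 ℤ.* w)  ≡⟨ cong (a ℤ.*_) (C-odd (+ j) d (+ n)) ⟨
        a ℤ.* C M                  ≡⟨ subst (λ M → a ℤ.* C M ≡ k ℤ.* F M) m≡M aC≡kF ⟩
        k ℤ.* F M                  ≡⟨ F-even k M² ⟩
        + 2 ℤ.* z                  ∎
        where
        C-odd : ∀ j d n → (+ 1 ℤ.+ + 2 ℤ.* j) ℤ.* (+ 1 ℤ.+ + 2 ℤ.* j) ℤ.- + 4 ℤ.* d ℤ.* (n ℤ.* n)
                        ≡ + 1 ℤ.+ + 2 ℤ.* (+ 2 ℤ.* j ℤ.+ + 2 ℤ.* (j ℤ.* j) ℤ.- + 2 ℤ.* d ℤ.* (n ℤ.* n))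
        C-odd = ℤ-Ring.solve-∀
        F-even : ∀ k f → k ℤ.* (+ 4 ℤ.* f) ≡ + 2 ℤ.* (+ 2 ℤ.* f ℤ.* k)
        F-even = ℤ-Ring.solve-∀

    tr-mulK-tauK-even : OddN m → + n ≢ + 0 → ∀ α β →
      InEnd d (tauK n m) α → InEnd d (tauK n m) β → EvenQ (tr (mulK d α β))
    tr-mulK-tauK-even m-odd n≢0 α β α∈End β∈End =
      tr-mulK-even d τ (+ 1 , refl) {α} {β} (element α α∈End) (element β β∈End)
        (a-even (element α α∈End)) (a-even (element β β∈End))
      where
      τ : K
      τ = tauK n m
      element : ∀ α → InEnd d τ α → EndElement d τ α
      element α = inEnd⇒endElement d τ (/≢0 {+ n} m n≢0) {α}
      a-even : ∀ {α} (p : EndElement d τ α) → EvenQ (EndElement.a p / 1)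
      a-even (endElement a _ _ a·norm) = a·norm-integral⇒even m-odd a a·norm

open EndomorphismRing using (order-basis; /≢0; tr-mulK-tauK-even; even-det)
open import Data.Integer using (ℤ; +_; _<_; _+_; _*_)
open import Data.Product using (_,_)

corollary3p11 : (d : ℤ) → d < + 0 → SquareFree d → Σ ℤ (λ k → d ≡ + 1 + + 4 * k)
    → (n m : ℕ) → .{{_ : NonZero m}} → OddN n → OddN m
    → IsEvenCurve d (tauK n m)
corollary3p11 d _ _ _ n m (_ , refl) m-odd =
  (_ , _ , order-basis d (tauK n m) (/≢0 {+ n} m (λ ())) (+ 1 , refl)) ,
  λ β₁ β₂ (β₁∈End , β₂∈End , _) →
    even-det (tr-even β₁ β₁ β₁∈End β₁∈End) (tr-even β₂ β₂ β₂∈End β₂∈End)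
             (tr-even β₁ β₂ β₁∈End β₂∈End) (tr-even β₂ β₁ β₂∈End β₁∈End)
  where
  tr-even : ∀ α β → InEnd d (tauK n m) α → InEnd d (tauK n m) β → EvenQ (tr (mulK d α β))
  tr-even = tr-mulK-tauK-even d n m m-odd (λ ())
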